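{- Let $G_1$, $G_2$ be graphs whose vertex sets intersect in exactly one vertex $v$. If for some $i\in\{1,2\}$ the graph $G_i$ has a minimum independent dominating set $S_i$ containing $v$ such that $S_i\setminus\{v\}$ is a dominating set of $G_i-v$, then $i(G_1\cup G_2)=i(G_1)+i(G_2)-1$.
   Context: All graphs are finite and simple. A dominating set of a graph is a set $S$ of vertices such that every vertex not in $S$ has a neighbor in $S$; an independent dominating set is a dominating set whose vertices are pairwise non-adjacent; $i(G)$ denotes the minimum size of an independent dominating set of $G$, and a minimum independent dominating set is one of size $i(G)$. $G_i-v$ is the graph obtained from $G_i$ by deleting $v$. -}

module Defs where

open import Data.Nat using (ℕ; _≤_)
open import Data.Fin using (Fin)
open import Data.Fin.Subset using (Subset; _∈_; _∉_; _⊆_; ∣_∣) renaming (_∪_ to _∪ₛ_; _-_ to _-ₛ_)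
open import Data.Fin.Subset.Properties using (x∈p∪q⁺)
open import Data.Product using (Σ; _×_; _,_; proj₁; proj₂)
open import Data.Sum using (_⊎_; inj₁; inj₂)
open import Relation.Nullary using (¬_)
open import Relation.Binary.PropositionalEquality using (_≡_)

-- A finite simple graph whose vertex set is a subset V of the ambient
-- finite type Fin n (so that two graphs may share vertices).
record Graph (n : ℕ) : Set₁ where
  field
    V       : Subset n
    Adj     : Fin n → Fin n → Set
    sym     : ∀ {x y} → Adj x y → Adj y x
    irrefl  : ∀ {x} → ¬ Adj x x
    inV     : ∀ {x y} → Adj x y → x ∈ V × y ∈ V
open Graph public

_∪ᴳ_ : ∀ {n} → Graph n → Graph n → Graph n
G ∪ᴳ H = record
  { V = V G ∪ₛ V H
  ; Adj = λ x y → Adj G x y ⊎ Adj H x y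
  ; sym = λ { (inj₁ a) → inj₁ (Graph.sym G a) ; (inj₂ a) → inj₂ (Graph.sym H a) }
  ; irrefl = λ { (inj₁ a) → irrefl G a ; (inj₂ a) → irrefl H a }
  ; inV = λ { (inj₁ a) → x∈p∪q⁺ (inj₁ (proj₁ (inV G a))) , x∈p∪q⁺ (inj₁ (proj₂ (inV G a)))
            ; (inj₂ a) → x∈p∪q⁺ (inj₂ (proj₁ (inV H a))) , x∈p∪q⁺ (inj₂ (proj₂ (inV H a))) }
  }

_-ᴳ_ : ∀ {n} → Graph n → Fin n → Graph n
G -ᴳ v = record
  { V = V G -ₛ v
  ; Adj = λ x y → Adj G x y × x ∈ V G -ₛ v × y ∈ V G -ₛ v
  ; sym = λ { (a , p , q) → Graph.sym G a , q , p }
  ; irrefl = λ { (a , _ , _) → irrefl G a }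
  ; inV = λ { (a , p , q) → p , q }
  }

IsDominating : ∀ {n} → Graph n → Subset n → Set
IsDominating G S = S ⊆ V G × (∀ x → x ∈ V G → x ∉ S → Σ (Fin _) λ y → y ∈ S × Adj G x y)

IsIndependent : ∀ {n} → Graph n → Subset n → Set
IsIndependent G S = ∀ x y → x ∈ S → y ∈ S → ¬ Adj G x y

IsIndDom : ∀ {n} → Graph n → Subset n → Set
IsIndDom G S = IsDominating G S × IsIndependent G S

IsMinIndDom : ∀ {n} → Graph n → Subset n → Set
IsMinIndDom G S = IsIndDom G S × (∀ T → IsIndDom G T → ∣ S ∣ ≤ ∣ T ∣)

IsIndDomNumber : ∀ {n} → Graph n → ℕ → Set
IsIndDomNumber G k = Σ (Subset _) λ S → IsMinIndDom G S × ∣ S ∣ ≡ k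

MeetExactlyAt : ∀ {n} → Graph n → Graph n → Fin n → Set
MeetExactlyAt G₁ G₂ v = v ∈ V G₁ × v ∈ V G₂ × (∀ x → x ∈ V G₁ → x ∈ V G₂ → x ≡ v)

GoodAt : ∀ {n} → Graph n → Fin n → Set
GoodAt G v = Σ (Subset _) λ S → IsMinIndDom G S × v ∈ S × IsDominating (G -ᴳ v) (S -ₛ v)

{-# OPTIONS --safe #-}
module Submission where

-- An independent dominating set T of G₁ ∪ G₂ meets each V Gᵢ in a set that is independent in Gᵢ
-- and dominates every vertex of Gᵢ except possibly v. Such a set is an independent dominating set
-- of Gᵢ as soon as v is in it or has a neighbour in it, and becomes one after adding v otherwise.
-- Either v ∈ T, and the two traces overlap in v, or v has a neighbour in T inside some Gᵢ; in both
-- cases i(G₁) + i(G₂) ≤ |T| + 1. Conversely, with S₁ as in the hypothesis and S₂ a minimum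
-- independent dominating set of G₂, the set S₁ ∪ S₂ (if v ∈ S₂) or (S₁ ∖ {v}) ∪ S₂ (if v ∉ S₂)
-- is independent and dominating in G₁ ∪ G₂, of size i(G₁) + i(G₂) − 1.

open import Defs renaming (sym to Adj-sym)
open import Data.Nat using (ℕ; suc; _+_; _∸_; _≤_; _≤?_; s≤s)
open import Data.Nat.Properties
  using (≤-antisym; ≤-trans; m≤m+n; ≤-reflexive; m≤n⇒m≤1+n; +-mono-≤; +-monoˡ-≤; +-monoʳ-≤; ∸-monoˡ-≤;
         +-suc; +-comm; +-identityʳ; module ≤-Reasoning)
open import Data.Fin using (Fin; _≟_)
open import Data.Fin.Subset using (Subset; _∈_; _∉_; _⊆_; ∣_∣; ⁅_⁆; inside; outside)
  renaming (_∪_ to _∪ₛ_; _∩_ to _∩ₛ_; _─_ to _─ₛ_; _-_ to _-ₛ_)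
open import Data.Fin.Subset.Properties
  using (_∈?_; x∈p∪q⁺; x∈p∪q⁻; x∈p∩q⁺; x∈p∩q⁻; p⊆q⇒∣p∣≤∣q∣; ∣p∩q∣≤∣p∣; ∣⁅x⁆∣≡1; ∣⊥∣≡0; x∈⁅x⁆;
         x∈⁅y⁆⇒x≡y; x∉⁅y⁆⇒x≢y; x∈p∧x≢y⇒x∈p-y; x∈p⇒∣p-x∣<∣p∣; p─q⊆p; ⊆-antisym; Empty-unique;
         ∪-comm; ∩-distribˡ-∪)
open import Data.Vec.Base using (_∷_; []; here; there)
open import Data.Product using (Σ; _×_; _,_; proj₁; proj₂)
open import Data.Sum using (_⊎_; inj₁; inj₂) renaming (swap to ⊎-swap)
open import Data.Empty using (⊥-elim)
open import Function using (_∘_; const)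
open import Relation.Nullary using (¬_; Dec; yes; no; contradiction)
open import Relation.Nullary.Decidable using (decidable-stable; ¬¬-excluded-middle)
open import Relation.Binary.PropositionalEquality
  using (_≡_; _≢_; refl; sym; trans; cong; cong₂; subst; module ≡-Reasoning)

private
  variable
    n k : ℕ
    x v : Fin n
    p q S T D₁ D₂ : Subset n
    H G₁ G₂ : Graph n

∣p∪q∣+∣p∩q∣≡∣p∣+∣q∣ : (p q : Subset n) → ∣ p ∪ₛ q ∣ + ∣ p ∩ₛ q ∣ ≡ ∣ p ∣ + ∣ q ∣
∣p∪q∣+∣p∩q∣≡∣p∣+∣q∣ [] [] = refl
∣p∪q∣+∣p∩q∣≡∣p∣+∣q∣ (inside ∷ p) (inside ∷ q) = cong suc (begin
  ∣ p ∪ₛ q ∣ + suc ∣ p ∩ₛ q ∣  ≡⟨ +-suc ∣ p ∪ₛ q ∣ ∣ p ∩ₛ q ∣ ⟩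
  suc (∣ p ∪ₛ q ∣ + ∣ p ∩ₛ q ∣) ≡⟨ cong suc (∣p∪q∣+∣p∩q∣≡∣p∣+∣q∣ p q) ⟩
  suc (∣ p ∣ + ∣ q ∣)           ≡⟨ sym (+-suc ∣ p ∣ ∣ q ∣) ⟩
  ∣ p ∣ + suc ∣ q ∣             ∎)
  where open ≡-Reasoning
∣p∪q∣+∣p∩q∣≡∣p∣+∣q∣ (inside ∷ p) (outside ∷ q) = cong suc (∣p∪q∣+∣p∩q∣≡∣p∣+∣q∣ p q)
∣p∪q∣+∣p∩q∣≡∣p∣+∣q∣ (outside ∷ p) (inside ∷ q) =
  trans (cong suc (∣p∪q∣+∣p∩q∣≡∣p∣+∣q∣ p q)) (sym (+-suc ∣ p ∣ ∣ q ∣))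
∣p∪q∣+∣p∩q∣≡∣p∣+∣q∣ (outside ∷ p) (outside ∷ q) = ∣p∪q∣+∣p∩q∣≡∣p∣+∣q∣ p q

∣p∪⁅x⁆∣≤1+∣p∣ : (p : Subset n) (x : Fin n) → ∣ p ∪ₛ ⁅ x ⁆ ∣ ≤ suc ∣ p ∣
∣p∪⁅x⁆∣≤1+∣p∣ p x = begin
  ∣ p ∪ₛ ⁅ x ⁆ ∣                      ≤⟨ m≤m+n ∣ p ∪ₛ ⁅ x ⁆ ∣ ∣ p ∩ₛ ⁅ x ⁆ ∣ ⟩
  ∣ p ∪ₛ ⁅ x ⁆ ∣ + ∣ p ∩ₛ ⁅ x ⁆ ∣     ≡⟨ ∣p∪q∣+∣p∩q∣≡∣p∣+∣q∣ p ⁅ x ⁆ ⟩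
  ∣ p ∣ + ∣ ⁅ x ⁆ ∣                   ≡⟨ cong (∣ p ∣ +_) (∣⁅x⁆∣≡1 x) ⟩
  ∣ p ∣ + 1                           ≡⟨ +-comm ∣ p ∣ 1 ⟩
  suc ∣ p ∣                           ∎
  where open ≤-Reasoning

∣p∩q∣+∣p∩r∣≤∣p∣+∣p∩q∩p∩r∣ : (p q r : Subset n) →
  ∣ p ∩ₛ q ∣ + ∣ p ∩ₛ r ∣ ≤ ∣ p ∣ + ∣ (p ∩ₛ q) ∩ₛ (p ∩ₛ r) ∣
∣p∩q∣+∣p∩r∣≤∣p∣+∣p∩q∩p∩r∣ p q r = begin
  ∣ p ∩ₛ q ∣ + ∣ p ∩ₛ r ∣                    ≡⟨ sym (∣p∪q∣+∣p∩q∣≡∣p∣+∣q∣ (p ∩ₛ q) (p ∩ₛ r)) ⟩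
  ∣ (p ∩ₛ q) ∪ₛ (p ∩ₛ r) ∣ + ∣ pq∩pr ∣     ≡⟨ cong (λ s → ∣ s ∣ + ∣ pq∩pr ∣) (sym (∩-distribˡ-∪ p q r)) ⟩
  ∣ p ∩ₛ (q ∪ₛ r) ∣ + ∣ pq∩pr ∣            ≤⟨ +-monoˡ-≤ ∣ pq∩pr ∣ (∣p∩q∣≤∣p∣ p (q ∪ₛ r)) ⟩
  ∣ p ∣ + ∣ pq∩pr ∣                        ∎
  where
  open ≤-Reasoning
  pq∩pr = (p ∩ₛ q) ∩ₛ (p ∩ₛ r)

x∈p─q⇒x∉q : (p q : Subset n) → x ∈ p ─ₛ q → x ∉ q
x∈p─q⇒x∉q (_ ∷ p) (outside ∷ q) here       ()
x∈p─q⇒x∉q (_ ∷ p) (_ ∷ q)       (there x∈) (there x∈q) = x∈p─q⇒x∉q p q x∈ x∈q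

x∈p⇒∣p∣≡1+∣p-x∣ : x ∈ p → ∣ p ∣ ≡ suc ∣ p -ₛ x ∣
x∈p⇒∣p∣≡1+∣p-x∣ {x = x} {p = p} x∈p =
  ≤-antisym (≤-trans (p⊆q⇒∣p∣≤∣q∣ p⊆p-x∪x) (∣p∪⁅x⁆∣≤1+∣p∣ (p -ₛ x) x)) (x∈p⇒∣p-x∣<∣p∣ x∈p)
  where
  p⊆p-x∪x : p ⊆ (p -ₛ x) ∪ₛ ⁅ x ⁆
  p⊆p-x∪x {y} y∈p with y ≟ x
  ... | yes refl = x∈p∪q⁺ (inj₂ (x∈⁅x⁆ x))
  ... | no y≢x   = x∈p∪q⁺ (inj₁ (x∈p∧x≢y⇒x∈p-y y∈p y≢x))

HasNeighbourIn : Graph n → Subset n → Fin n → Set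
HasNeighbourIn H S x = Σ (Fin _) λ y → y ∈ S × Adj H x y

HasNeighbourIn-∩V : ∀ {y} → Adj H x y → y ∈ T → HasNeighbourIn H (T ∩ₛ V H) x
HasNeighbourIn-∩V {H = H} {y = y} a y∈T = y , x∈p∩q⁺ (y∈T , proj₂ (inV H a)) , a

IsIndDomLowerBound : Graph n → ℕ → Set
IsIndDomLowerBound G k = ∀ S → IsIndDom G S → k ≤ ∣ S ∣

IsIndDomNumber⇒lowerBound : IsIndDomNumber H k → IsIndDomLowerBound H k
IsIndDomNumber⇒lowerBound (S , (_ , S-min) , refl) = S-min

IsMinIndDom⇒∣∣≡ : IsMinIndDom H S → IsIndDomNumber H k → ∣ S ∣ ≡ k
IsMinIndDom⇒∣∣≡ {H = H} {S = S} (S-ids , S-min) k-num@(S′ , (S′-ids , _) , ∣S′∣≡k) =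
  ≤-antisym (subst (∣ S ∣ ≤_) ∣S′∣≡k (S-min S′ S′-ids)) (IsIndDomNumber⇒lowerBound {H = H} k-num S S-ids)

IsIndDomNumber-intro : IsIndDom H S → IsIndDomLowerBound H k → ∣ S ∣ ≡ k → IsIndDomNumber H k
IsIndDomNumber-intro {S = S} S-ids lb ∣S∣≡k =
  S , (S-ids , λ T T-ids → subst (_≤ ∣ T ∣) (sym ∣S∣≡k) (lb T T-ids)) , ∣S∣≡k

IsIndDomExcept : Graph n → Fin n → Subset n → Set
IsIndDomExcept H v S =
  S ⊆ V H × (∀ x → x ∈ V H → x ∉ S → x ≢ v → HasNeighbourIn H S x) × IsIndependent H S

IsIndDom⇒IsIndDomExcept : IsIndDom H S → IsIndDomExcept H v S
IsIndDom⇒IsIndDomExcept ((S⊆V , dom) , ind) = S⊆V , (λ x x∈V x∉S _ → dom x x∈V x∉S) , ind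

IsIndDomExcept-complete : IsIndDomExcept H v S → (v ∉ S → HasNeighbourIn H S v) → IsIndDom H S
IsIndDomExcept-complete {H = H} {v = v} {S = S} (S⊆V , dom , ind) v-dom = (S⊆V , dom′) , ind
  where
  dom′ : ∀ x → x ∈ V H → x ∉ S → HasNeighbourIn H S x
  dom′ x x∈V x∉S with x ≟ v
  ... | yes refl = v-dom x∉S
  ... | no x≢v   = dom x x∈V x∉S x≢v

IsIndDomExcept-extend : v ∈ V H → IsIndDomExcept H v S → ¬ HasNeighbourIn H S v → IsIndDom H (S ∪ₛ ⁅ v ⁆)
IsIndDomExcept-extend {v = v} {H = H} {S = S} v∈V (S⊆V , dom , ind) v-isolated = (S∪v⊆V , dom′) , ind′
  where
  S∪v⊆V : S ∪ₛ ⁅ v ⁆ ⊆ V H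
  S∪v⊆V x∈ with x∈p∪q⁻ S ⁅ v ⁆ x∈
  ... | inj₁ x∈S = S⊆V x∈S
  ... | inj₂ x∈v with refl ← x∈⁅y⁆⇒x≡y v x∈v = v∈V
  dom′ : ∀ x → x ∈ V H → x ∉ S ∪ₛ ⁅ v ⁆ → HasNeighbourIn H (S ∪ₛ ⁅ v ⁆) x
  dom′ x x∈V x∉ =
    let y , y∈S , a = dom x x∈V (x∉ ∘ x∈p∪q⁺ ∘ inj₁) (x∉⁅y⁆⇒x≢y (x∉ ∘ x∈p∪q⁺ ∘ inj₂))
    in  y , x∈p∪q⁺ (inj₁ y∈S) , a
  ind′ : IsIndependent H (S ∪ₛ ⁅ v ⁆)
  ind′ x y x∈ y∈ a with x∈p∪q⁻ S ⁅ v ⁆ x∈ | x∈p∪q⁻ S ⁅ v ⁆ y∈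
  ... | inj₁ x∈S | inj₁ y∈S = ind x y x∈S y∈S a
  ... | inj₂ x∈v | inj₁ y∈S with refl ← x∈⁅y⁆⇒x≡y v x∈v = v-isolated (y , y∈S , a)
  ... | inj₁ x∈S | inj₂ y∈v with refl ← x∈⁅y⁆⇒x≡y v y∈v = v-isolated (x , x∈S , Adj-sym H a)
  ... | inj₂ x∈v | inj₂ y∈v with refl ← x∈⁅y⁆⇒x≡y v x∈v | refl ← x∈⁅y⁆⇒x≡y v y∈v = irrefl H a

-- Whether v has a neighbour in S is not decidable, but the conclusion is, so excluded middle may be
-- used under a double negation.
IsIndDomExcept⇒≤1+∣∣ : IsIndDomLowerBound H k → v ∈ V H → IsIndDomExcept H v S → k ≤ suc ∣ S ∣
IsIndDomExcept⇒≤1+∣∣ {H = H} {k = k} {v = v} {S = S} lb v∈V E = decidable-stable (k ≤? suc ∣ S ∣) λ k≰ →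
  ¬¬-excluded-middle {A = HasNeighbourIn H S v} λ where
    (yes v-dom)      → k≰ (m≤n⇒m≤1+n (lb S (IsIndDomExcept-complete {H = H} E (const v-dom))))
    (no v-isolated) → k≰ (≤-trans (lb _ (IsIndDomExcept-extend {H = H} v∈V E v-isolated)) (∣p∪⁅x⁆∣≤1+∣p∣ S v))

IsDominating-delete⇒IsIndDomExcept :
  IsIndependent H S → IsDominating (H -ᴳ v) (S -ₛ v) → IsIndDomExcept H v (S -ₛ v)
IsDominating-delete⇒IsIndDomExcept {H = H} {S = S} {v = v} ind (S-v⊆V-v , dom) =
  (λ x∈ → p─q⊆p (V H) ⁅ v ⁆ (S-v⊆V-v x∈)) ,
  (λ x x∈V x∉ x≢v → let y , y∈ , a , _ = dom x (x∈p∧x≢y⇒x∈p-y x∈V x≢v) x∉ in y , y∈ , a) ,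
  (λ x y x∈ y∈ → ind x y (p─q⊆p S ⁅ v ⁆ x∈) (p─q⊆p S ⁅ v ⁆ y∈))

MeetExactlyAt-sym : MeetExactlyAt G₁ G₂ v → MeetExactlyAt G₂ G₁ v
MeetExactlyAt-sym (v∈V₁ , v∈V₂ , shared) = v∈V₂ , v∈V₁ , λ x x∈V₂ x∈V₁ → shared x x∈V₁ x∈V₂

IsIndDom-∪ᴳ-comm : IsIndDom (G₁ ∪ᴳ G₂) T → IsIndDom (G₂ ∪ᴳ G₁) T
IsIndDom-∪ᴳ-comm {G₁ = G₁} {G₂ = G₂} {T = T} ((T⊆V , dom) , ind) =
  (subst (T ⊆_) (∪-comm (V G₁) (V G₂)) T⊆V ,
   λ x x∈V x∉T → let y , y∈T , a = dom x (subst (x ∈_) (∪-comm (V G₂) (V G₁)) x∈V) x∉T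
                 in  y , y∈T , ⊎-swap a) ,
  λ x y x∈T y∈T → ind x y x∈T y∈T ∘ ⊎-swap

IsIndDomNumber-∪ᴳ-comm : IsIndDomNumber (G₁ ∪ᴳ G₂) k → IsIndDomNumber (G₂ ∪ᴳ G₁) k
IsIndDomNumber-∪ᴳ-comm {G₁ = G₁} {G₂ = G₂} (S , (S-ids , S-min) , ∣S∣≡k) =
  S , (IsIndDom-∪ᴳ-comm {G₁ = G₁} {G₂ = G₂} S-ids ,
       λ T T-ids → S-min T (IsIndDom-∪ᴳ-comm {G₁ = G₂} {G₂ = G₁} T-ids)) ,
  ∣S∣≡k

module SharedVertex {n} (G₁ G₂ : Graph n) (v : Fin n) (meet : MeetExactlyAt G₁ G₂ v) where

  v∈V₁ : v ∈ V G₁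
  v∈V₁ = proj₁ meet

  v∈V₂ : v ∈ V G₂
  v∈V₂ = proj₁ (proj₂ meet)

  shared : ∀ {x} → x ∈ V G₁ → x ∈ V G₂ → x ≡ v
  shared = proj₂ (proj₂ meet) _

  ∩⊆⁅v⁆ : p ⊆ V G₁ → q ⊆ V G₂ → p ∩ₛ q ⊆ ⁅ v ⁆
  ∩⊆⁅v⁆ {p = p} {q = q} p⊆V₁ q⊆V₂ {x} x∈ with x∈p∩q⁻ p q x∈
  ... | x∈p , x∈q with refl ← shared (p⊆V₁ x∈p) (q⊆V₂ x∈q) = x∈⁅x⁆ x

  ∣∩∣≤1 : p ⊆ V G₁ → q ⊆ V G₂ → ∣ p ∩ₛ q ∣ ≤ 1
  ∣∩∣≤1 p⊆V₁ q⊆V₂ = ≤-trans (p⊆q⇒∣p∣≤∣q∣ (∩⊆⁅v⁆ p⊆V₁ q⊆V₂)) (≤-reflexive (∣⁅x⁆∣≡1 v))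

  ∣∩∣≡0 : p ⊆ V G₁ → q ⊆ V G₂ → v ∉ q → ∣ p ∩ₛ q ∣ ≡ 0
  ∣∩∣≡0 {p = p} {q = q} p⊆V₁ q⊆V₂ v∉q =
    trans (cong ∣_∣ (Empty-unique {p = p ∩ₛ q} λ (x , x∈) → v∉q (v∈q x∈))) (∣⊥∣≡0 n)
    where
    v∈q : x ∈ p ∩ₛ q → v ∈ q
    v∈q x∈ with refl ← x∈⁅y⁆⇒x≡y v (∩⊆⁅v⁆ p⊆V₁ q⊆V₂ x∈) = proj₂ (x∈p∩q⁻ p q x∈)

  ∣∩∣≡1 : p ⊆ V G₁ → q ⊆ V G₂ → v ∈ p → v ∈ q → ∣ p ∩ₛ q ∣ ≡ 1
  ∣∩∣≡1 {p = p} {q = q} p⊆V₁ q⊆V₂ v∈p v∈q = trans (cong ∣_∣ (⊆-antisym (∩⊆⁅v⁆ p⊆V₁ q⊆V₂) ⁅v⁆⊆)) (∣⁅x⁆∣≡1 v)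
    where
    ⁅v⁆⊆ : ⁅ v ⁆ ⊆ p ∩ₛ q
    ⁅v⁆⊆ x∈ with refl ← x∈⁅y⁆⇒x≡y v x∈ = x∈p∩q⁺ (v∈p , v∈q)

  IsIndDom-∪ᴳ⇒IsIndDomExcept : IsIndDom (G₁ ∪ᴳ G₂) T → IsIndDomExcept G₁ v (T ∩ₛ V G₁)
  IsIndDom-∪ᴳ⇒IsIndDomExcept {T = T} ((_ , dom) , ind) =
    (λ x∈ → proj₂ (x∈p∩q⁻ T (V G₁) x∈)) , dom₁ ,
    (λ x y x∈ y∈ a → ind x y (proj₁ (x∈p∩q⁻ T (V G₁) x∈)) (proj₁ (x∈p∩q⁻ T (V G₁) y∈)) (inj₁ a))
    where
    dom₁ : ∀ x → x ∈ V G₁ → x ∉ T ∩ₛ V G₁ → x ≢ v → HasNeighbourIn G₁ (T ∩ₛ V G₁) x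
    dom₁ x x∈V₁ x∉ x≢v with dom x (x∈p∪q⁺ (inj₁ x∈V₁)) (λ x∈T → x∉ (x∈p∩q⁺ (x∈T , x∈V₁)))
    ... | y , y∈T , inj₁ a = HasNeighbourIn-∩V {H = G₁} a y∈T
    ... | y , y∈T , inj₂ a = contradiction (shared x∈V₁ (proj₁ (inV G₂ a))) x≢v

  IsIndDom-∪ᴳ : IsIndDomExcept G₁ v D₁ → IsIndDom G₂ D₂ → (v ∈ D₁ → v ∈ D₂) → (v ∈ D₂ → v ∈ D₁) →
                IsIndDom (G₁ ∪ᴳ G₂) (D₁ ∪ₛ D₂)
  IsIndDom-∪ᴳ {D₁ = D₁} {D₂ = D₂} (D₁⊆V₁ , dom₁ , ind₁) ((D₂⊆V₂ , dom₂) , ind₂) v∈D₁⇒v∈D₂ v∈D₂⇒v∈D₁ =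
    (D⊆V , dom) , ind
    where
    D⊆V : D₁ ∪ₛ D₂ ⊆ V G₁ ∪ₛ V G₂
    D⊆V x∈ with x∈p∪q⁻ D₁ D₂ x∈
    ... | inj₁ x∈D₁ = x∈p∪q⁺ (inj₁ (D₁⊆V₁ x∈D₁))
    ... | inj₂ x∈D₂ = x∈p∪q⁺ (inj₂ (D₂⊆V₂ x∈D₂))
    ∈D₁ : ∀ {x} → x ∈ D₁ ∪ₛ D₂ → x ∈ V G₁ → x ∈ D₁
    ∈D₁ x∈ x∈V₁ with x∈p∪q⁻ D₁ D₂ x∈
    ... | inj₁ x∈D₁ = x∈D₁
    ... | inj₂ x∈D₂ with refl ← shared x∈V₁ (D₂⊆V₂ x∈D₂) = v∈D₂⇒v∈D₁ x∈D₂
    ∈D₂ : ∀ {x} → x ∈ D₁ ∪ₛ D₂ → x ∈ V G₂ → x ∈ D₂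
    ∈D₂ x∈ x∈V₂ with x∈p∪q⁻ D₁ D₂ x∈
    ... | inj₂ x∈D₂ = x∈D₂
    ... | inj₁ x∈D₁ with refl ← shared (D₁⊆V₁ x∈D₁) x∈V₂ = v∈D₁⇒v∈D₂ x∈D₁
    dom : ∀ x → x ∈ V G₁ ∪ₛ V G₂ → x ∉ D₁ ∪ₛ D₂ → HasNeighbourIn (G₁ ∪ᴳ G₂) (D₁ ∪ₛ D₂) x
    dom x x∈V x∉D with x ∈? V G₂ | x∈p∪q⁻ (V G₁) (V G₂) x∈V
    ... | yes x∈V₂ | _ =
      let y , y∈D₂ , a = dom₂ x x∈V₂ (x∉D ∘ x∈p∪q⁺ ∘ inj₂) in y , x∈p∪q⁺ (inj₂ y∈D₂) , inj₂ a
    ... | no x∉V₂ | inj₂ x∈V₂ = contradiction x∈V₂ x∉V₂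
    ... | no x∉V₂ | inj₁ x∈V₁ =
      let y , y∈D₁ , a = dom₁ x x∈V₁ (x∉D ∘ x∈p∪q⁺ ∘ inj₁) (λ { refl → x∉V₂ v∈V₂ })
      in  y , x∈p∪q⁺ (inj₁ y∈D₁) , inj₁ a
    ind : IsIndependent (G₁ ∪ᴳ G₂) (D₁ ∪ₛ D₂)
    ind x y x∈ y∈ (inj₁ a) = ind₁ x y (∈D₁ x∈ (proj₁ (inV G₁ a))) (∈D₁ y∈ (proj₂ (inV G₁ a))) a
    ind x y x∈ y∈ (inj₂ a) = ind₂ x y (∈D₂ x∈ (proj₁ (inV G₂ a))) (∈D₂ y∈ (proj₂ (inV G₂ a))) a

module Union {n} (G₁ G₂ : Graph n) (v : Fin n) (meet : MeetExactlyAt G₁ G₂ v) where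
  open SharedVertex G₁ G₂ v meet
  open SharedVertex G₂ G₁ v (MeetExactlyAt-sym {G₁ = G₁} {G₂ = G₂} meet) using ()
    renaming (IsIndDom-∪ᴳ⇒IsIndDomExcept to IsIndDom-∪ᴳ⇒IsIndDomExcept₂)

  ∪ᴳ-upperBound : ∀ {S₁ S₂} →
    IsIndDom G₁ S₁ → v ∈ S₁ → IsDominating (G₁ -ᴳ v) (S₁ -ₛ v) → IsIndDom G₂ S₂ →
    Σ (Subset n) λ D → IsIndDom (G₁ ∪ᴳ G₂) D × ∣ S₁ ∣ + ∣ S₂ ∣ ≡ suc ∣ D ∣
  ∪ᴳ-upperBound {S₁} {S₂} S₁-ids@((S₁⊆V₁ , _) , S₁-ind) v∈S₁ S₁-v-dom S₂-ids@((S₂⊆V₂ , _) , _)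
    with v ∈? S₂
  ... | yes v∈S₂ =
    S₁ ∪ₛ S₂ , IsIndDom-∪ᴳ (IsIndDom⇒IsIndDomExcept {H = G₁} S₁-ids) S₂-ids (const v∈S₂) (const v∈S₁) , (begin
      ∣ S₁ ∣ + ∣ S₂ ∣                    ≡⟨ sym (∣p∪q∣+∣p∩q∣≡∣p∣+∣q∣ S₁ S₂) ⟩
      ∣ S₁ ∪ₛ S₂ ∣ + ∣ S₁ ∩ₛ S₂ ∣       ≡⟨ cong (∣ S₁ ∪ₛ S₂ ∣ +_) (∣∩∣≡1 S₁⊆V₁ S₂⊆V₂ v∈S₁ v∈S₂) ⟩
      ∣ S₁ ∪ₛ S₂ ∣ + 1                   ≡⟨ +-comm ∣ S₁ ∪ₛ S₂ ∣ 1 ⟩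
      suc ∣ S₁ ∪ₛ S₂ ∣                   ∎)
    where open ≡-Reasoning
  ... | no v∉S₂ =
    S₁-v ∪ₛ S₂ , IsIndDom-∪ᴳ E S₂-ids (⊥-elim ∘ v∉S₁-v) (⊥-elim ∘ v∉S₂) , (begin
      ∣ S₁ ∣ + ∣ S₂ ∣                    ≡⟨ cong (_+ ∣ S₂ ∣) (x∈p⇒∣p∣≡1+∣p-x∣ v∈S₁) ⟩
      suc (∣ S₁-v ∣ + ∣ S₂ ∣)            ≡⟨ cong suc (sym (∣p∪q∣+∣p∩q∣≡∣p∣+∣q∣ S₁-v S₂)) ⟩
      suc (∣ S₁-v ∪ₛ S₂ ∣ + ∣ S₁-v ∩ₛ S₂ ∣) ≡⟨ cong (suc ∘ (∣ S₁-v ∪ₛ S₂ ∣ +_)) (∣∩∣≡0 (proj₁ E) S₂⊆V₂ v∉S₂) ⟩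
      suc (∣ S₁-v ∪ₛ S₂ ∣ + 0)           ≡⟨ cong suc (+-identityʳ ∣ S₁-v ∪ₛ S₂ ∣) ⟩
      suc ∣ S₁-v ∪ₛ S₂ ∣                 ∎)
    where
    open ≡-Reasoning
    S₁-v = S₁ -ₛ v
    E : IsIndDomExcept G₁ v S₁-v
    E = IsDominating-delete⇒IsIndDomExcept {H = G₁} S₁-ind S₁-v-dom
    v∉S₁-v : v ∉ S₁-v
    v∉S₁-v v∈ = x∈p─q⇒x∉q S₁ ⁅ v ⁆ v∈ (x∈⁅x⁆ v)

  ∪ᴳ-lowerBound : ∀ {k₁ k₂} → IsIndDomLowerBound G₁ k₁ → IsIndDomLowerBound G₂ k₂ →
                  ∀ T → IsIndDom (G₁ ∪ᴳ G₂) T → k₁ + k₂ ≤ suc ∣ T ∣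
  ∪ᴳ-lowerBound {k₁} {k₂} lb₁ lb₂ T T-ids@((_ , T-dom) , _) = bound (v ∈? T)
    where
    open ≤-Reasoning
    A = T ∩ₛ V G₁
    B = T ∩ₛ V G₂
    A⊆V₁ : A ⊆ V G₁
    A⊆V₁ x∈ = proj₂ (x∈p∩q⁻ T (V G₁) x∈)
    B⊆V₂ : B ⊆ V G₂
    B⊆V₂ x∈ = proj₂ (x∈p∩q⁻ T (V G₂) x∈)
    E₁ : IsIndDomExcept G₁ v A
    E₁ = IsIndDom-∪ᴳ⇒IsIndDomExcept T-ids
    E₂ : IsIndDomExcept G₂ v B
    E₂ = IsIndDom-∪ᴳ⇒IsIndDomExcept₂ (IsIndDom-∪ᴳ-comm {G₁ = G₁} {G₂ = G₂} T-ids)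
    v∉T⇒∣A∣+∣B∣≤∣T∣ : v ∉ T → ∣ A ∣ + ∣ B ∣ ≤ ∣ T ∣
    v∉T⇒∣A∣+∣B∣≤∣T∣ v∉T = begin
      ∣ A ∣ + ∣ B ∣           ≤⟨ ∣p∩q∣+∣p∩r∣≤∣p∣+∣p∩q∩p∩r∣ T (V G₁) (V G₂) ⟩
      ∣ T ∣ + ∣ A ∩ₛ B ∣      ≡⟨ cong (∣ T ∣ +_) (∣∩∣≡0 A⊆V₁ B⊆V₂ (v∉T ∘ proj₁ ∘ x∈p∩q⁻ T (V G₂))) ⟩
      ∣ T ∣ + 0               ≡⟨ +-identityʳ ∣ T ∣ ⟩
      ∣ T ∣                   ∎
    A-complete : (v ∉ A → HasNeighbourIn G₁ A v) → k₁ ≤ ∣ A ∣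
    A-complete = lb₁ A ∘ IsIndDomExcept-complete {H = G₁} E₁
    B-complete : (v ∉ B → HasNeighbourIn G₂ B v) → k₂ ≤ ∣ B ∣
    B-complete = lb₂ B ∘ IsIndDomExcept-complete {H = G₂} E₂
    bound : Dec (v ∈ T) → k₁ + k₂ ≤ suc ∣ T ∣
    bound (yes v∈T) = begin
      k₁ + k₂                 ≤⟨ +-mono-≤ (A-complete (contradiction (x∈p∩q⁺ (v∈T , v∈V₁))))
                                          (B-complete (contradiction (x∈p∩q⁺ (v∈T , v∈V₂)))) ⟩
      ∣ A ∣ + ∣ B ∣           ≤⟨ ∣p∩q∣+∣p∩r∣≤∣p∣+∣p∩q∩p∩r∣ T (V G₁) (V G₂) ⟩
      ∣ T ∣ + ∣ A ∩ₛ B ∣      ≤⟨ +-monoʳ-≤ ∣ T ∣ (∣∩∣≤1 A⊆V₁ B⊆V₂) ⟩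
      ∣ T ∣ + 1               ≡⟨ +-comm ∣ T ∣ 1 ⟩
      suc ∣ T ∣               ∎
    bound (no v∉T) with T-dom v (x∈p∪q⁺ (inj₁ v∈V₁)) v∉T
    ... | y , y∈T , inj₁ a = begin
      k₁ + k₂                 ≤⟨ +-mono-≤ (A-complete (const (HasNeighbourIn-∩V {H = G₁} a y∈T)))
                                          (IsIndDomExcept⇒≤1+∣∣ {H = G₂} lb₂ v∈V₂ E₂) ⟩
      ∣ A ∣ + suc ∣ B ∣       ≡⟨ +-suc ∣ A ∣ ∣ B ∣ ⟩
      suc (∣ A ∣ + ∣ B ∣)     ≤⟨ s≤s (v∉T⇒∣A∣+∣B∣≤∣T∣ v∉T) ⟩
      suc ∣ T ∣               ∎
    ... | y , y∈T , inj₂ a = begin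
      k₁ + k₂                 ≤⟨ +-mono-≤ (IsIndDomExcept⇒≤1+∣∣ {H = G₁} lb₁ v∈V₁ E₁)
                                          (B-complete (const (HasNeighbourIn-∩V {H = G₂} a y∈T))) ⟩
      suc (∣ A ∣ + ∣ B ∣)     ≤⟨ s≤s (v∉T⇒∣A∣+∣B∣≤∣T∣ v∉T) ⟩
      suc ∣ T ∣               ∎

  IsIndDomNumber-∪ᴳ : ∀ {k₁ k₂} → GoodAt G₁ v → IsIndDomNumber G₁ k₁ → IsIndDomNumber G₂ k₂ →
                      IsIndDomNumber (G₁ ∪ᴳ G₂) (k₁ + k₂ ∸ 1)
  IsIndDomNumber-∪ᴳ {k₁} {k₂} (S₁ , S₁-min , v∈S₁ , S₁-v-dom) k₁-num k₂-num@(S₂ , (S₂-ids , _) , ∣S₂∣≡k₂)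
    with ∪ᴳ-upperBound (proj₁ S₁-min) v∈S₁ S₁-v-dom S₂-ids
  ... | D , D-ids , ∣S₁∣+∣S₂∣≡1+∣D∣ = IsIndDomNumber-intro {H = G₁ ∪ᴳ G₂} D-ids lowerBound (cong (_∸ 1) (begin
      suc ∣ D ∣        ≡⟨ sym ∣S₁∣+∣S₂∣≡1+∣D∣ ⟩
      ∣ S₁ ∣ + ∣ S₂ ∣  ≡⟨ cong₂ _+_ (IsMinIndDom⇒∣∣≡ {H = G₁} S₁-min k₁-num) ∣S₂∣≡k₂ ⟩
      k₁ + k₂          ∎))
    where
    open ≡-Reasoning
    lowerBound : IsIndDomLowerBound (G₁ ∪ᴳ G₂) (k₁ + k₂ ∸ 1)
    lowerBound T T-ids = ∸-monoˡ-≤ 1 (∪ᴳ-lowerBound (IsIndDomNumber⇒lowerBound {H = G₁} k₁-num)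
                                                   (IsIndDomNumber⇒lowerBound {H = G₂} k₂-num) T T-ids)

lemma2p2 : ∀ {n} (G₁ G₂ : Graph n) (v : Fin n) (k₁ k₂ : ℕ) →
    MeetExactlyAt G₁ G₂ v →
    (GoodAt G₁ v ⊎ GoodAt G₂ v) →
    IsIndDomNumber G₁ k₁ → IsIndDomNumber G₂ k₂ →
    IsIndDomNumber (G₁ ∪ᴳ G₂) (k₁ + k₂ ∸ 1)
lemma2p2 G₁ G₂ v k₁ k₂ meet (inj₁ good₁) k₁-num k₂-num =
  Union.IsIndDomNumber-∪ᴳ G₁ G₂ v meet good₁ k₁-num k₂-num
lemma2p2 G₁ G₂ v k₁ k₂ meet (inj₂ good₂) k₁-num k₂-num =
  IsIndDomNumber-∪ᴳ-comm {G₁ = G₂} {G₂ = G₁}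
    (subst (IsIndDomNumber (G₂ ∪ᴳ G₁) ∘ (_∸ 1)) (+-comm k₂ k₁)
      (Union.IsIndDomNumber-∪ᴳ G₂ G₁ v (MeetExactlyAt-sym {G₁ = G₁} {G₂ = G₂} meet) good₂ k₂-num k₁-num))
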